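{- Let $n>1$, $\textsf{AP}=\{p\}$, and let $K_n$ and $M_n$ be tree structures as described in the context. Then $M_n\not\models\varphi_p$, where $\varphi_p$ is the HyperLTL sentence $\exists x.\exists y.\; p[x]\,\textsf{U}\,\big((p[x]\wedge\neg p[y])\wedge\textsf{X}\textsf{G}(p[x]\leftrightarrow p[y])\big)$.
   Context: HyperCTL$^*$/HyperLTL semantics on a Kripke structure $K$ (with total transition relation and valuation $V$): formulas are evaluated w.r.t. a path assignment $\Pi$ (variables to initial paths), a current variable $y$ and a position $i$; $\Pi,y,i\models p[x]$ iff $p\in V(\Pi(x)(i))$; Booleans, $\textsf{X}$, $\textsf{U}$ standard on the position; $\textsf{F}\varphi=\top\textsf{U}\varphi$, $\textsf{G}\varphi=\neg\textsf{F}\neg\varphi$; $\Pi,y,i\models\exists x.\varphi$ iff some initial path $\pi$ with $\pi[0,i]=\Pi(y)[0,i]$ gives $\Pi[x\leftarrow\pi],x,i\models\varphi$. For a sentence, $K\models\varphi$ iff $\Pi,y,0\models\varphi$ for some (equivalently any) $\Pi,y$. A tree structure has nodes forming a prefix-closed subset of $\mathbb{N}^*$ with root $\varepsilon$ initial and edges only from $\tau$ to children $\tau\cdot i$; it is regular if it is the unwinding of a finite Kripke structure. $K_n$ is any regular tree structure over $2^{\{p\}}$ such that for some $\ell_n>1$: the root has label $\{p\}$ and exactly $2n+1$ successors $\eta,\xi_1,\ldots,\xi_{2n}$, with a unique initial path through $\eta$ (denoted $\pi(\eta)$) and through each $\xi_k$ (denoted $\pi(\xi_k)$); there are $2n+1$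 distinct words $w_0,\ldots,w_{2n}$ over $2^{\{p\}}$ of length $\ell_n$ with $w_0=\{p\}^{\ell_n}$, $w_n(\ell_n-1)=\emptyset$, $w_{n-1}(\ell_n-1)=\{p\}$, the trace of $\pi(\eta)$ is $\{p\}w_0\emptyset^n\{p\}^n\{p\}^\omega$ and the trace of $\pi(\xi_k)$ is $\{p\}w_k\emptyset^{2n-k}\{p\}^k\{p\}^\omega$ for $k\in[1,2n]$. $M_n$ is obtained from $K_n$ by replacing the label $\{p\}$ of the node $\pi(\xi_n)(\ell_n+1+n)$ with $\emptyset$. -}

module Defs where

open import Data.Nat using (ℕ; zero; suc; _+_; _*_; _∸_; _≤_; _<_; s≤s; z≤n; _<?_)
open import Data.Nat using (_≟_)
open import Data.Fin using (Fin; toℕ; fromℕ<)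
open import Data.Bool using (Bool; true; false; if_then_else_)
open import Data.List using (List; []; _∷_; _∷ʳ_)
open import Data.List.Properties as LP using ()
open import Data.Vec using (Vec; lookup; last; replicate)
open import Data.Product using (Σ; ∃; _×_; _,_; proj₁; proj₂)
open import Data.Unit using (⊤)
open import Relation.Nullary using (¬_; yes; no; Dec)
open import Relation.Nullary.Decidable using (⌊_⌋)
open import Relation.Binary.PropositionalEquality using (_≡_; refl)
import Data.Nat as N

-- Kripke structures.  AP = {p}, so a label in 2^{p} is a Bool
-- (true = {p}, false = ∅).  A Kripke structure is a Frame together with
-- a valuation  State → Bool.

record Frame : Set₁ where
  field
    State : Set
    Init  : State → Set
    R     : State → State → Set
    total : ∀ s → ∃ λ t → R s t
open Frame public

record Path (F : Frame) : Set where
  field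
    at   : ℕ → State F
    step : ∀ i → R F (at i) (at (suc i))
open Path public

InitPath : Frame → Set
InitPath F = Σ (Path F) (λ π → Init F (at π 0))

data Form : Set where
  ⊤f   : Form
  P    : ℕ → Form
  ¬f   : Form → Form
  _∧f_ : Form → Form → Form
  Xf   : Form → Form
  _Uf_ : Form → Form → Form
  ∃f   : ℕ → Form → Form

Ff : Form → Form
Ff φ = ⊤f Uf φ

Gf : Form → Form
Gf φ = ¬f (Ff (¬f φ))

_⇒f_ : Form → Form → Form
φ ⇒f ψ = ¬f (φ ∧f ¬f ψ)

_⇔f_ : Form → Form → Form
φ ⇔f ψ = (φ ⇒f ψ) ∧f (ψ ⇒f φ)

_[_↦_] : {A : Set} → (ℕ → A) → ℕ → A → (ℕ → A)
(Π [ x ↦ π ]) v with x ≟ v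
... | yes _ = π
... | no  _ = Π v

Sat : (F : Frame) → (State F → Bool) →
      (ℕ → InitPath F) → ℕ → ℕ → Form → Set
Sat F V Π y i ⊤f        = ⊤
Sat F V Π y i (P x)     = V (at (proj₁ (Π x)) i) ≡ true
Sat F V Π y i (¬f φ)    = ¬ Sat F V Π y i φ
Sat F V Π y i (φ ∧f ψ)  = Sat F V Π y i φ × Sat F V Π y i ψ
Sat F V Π y i (Xf φ)    = Sat F V Π y (suc i) φ
Sat F V Π y i (φ Uf ψ)  =
  ∃ λ j → i ≤ j × Sat F V Π y j ψ × (∀ k → i ≤ k → k < j → Sat F V Π y k φ)
Sat F V Π y i (∃f x φ)  =
  Σ (InitPath F) λ π →
    (∀ k → k ≤ i → at (proj₁ π) k ≡ at (proj₁ (Π y)) k) ×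
    Sat F V (Π [ x ↦ π ]) x i φ

_,_⊨_ : (F : Frame) → (State F → Bool) → Form → Set
F , V ⊨ φ = Σ (ℕ → InitPath F) λ Π → Σ ℕ λ y → Sat F V Π y 0 φ

-- φ_p = ∃x.∃y. p[x] U ((p[x] ∧ ¬p[y]) ∧ X G (p[x] ↔ p[y]))   (x = 0, y = 1)
φp : Form
φp = ∃f 0 (∃f 1 (P 0 Uf ((P 0 ∧f ¬f (P 1)) ∧f Xf (Gf (P 0 ⇔f P 1)))))

-- Tree structures: nodes form a prefix-closed subset of ℕ*, the child of
-- τ is τ·i = τ ∷ʳ i; root ε = [] is the (only) initial state; edges go
-- exactly from τ to its children τ·i that are nodes.

record TreeStructure : Set where
  field
    T            : List ℕ → Bool
    root         : T [] ≡ true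
    prefixClosed : ∀ τ i → T (τ ∷ʳ i) ≡ true → T τ ≡ true
    hasChild     : ∀ τ → T τ ≡ true → ∃ λ i → T (τ ∷ʳ i) ≡ true
open TreeStructure public

Node : TreeStructure → Set
Node tr = Σ (List ℕ) (λ τ → T tr τ ≡ true)

treeFrame : TreeStructure → Frame
treeFrame tr = record
  { State = Node tr
  ; Init  = λ s → proj₁ s ≡ []
  ; R     = λ s t → ∃ λ i → proj₁ t ≡ proj₁ s ∷ʳ i
  ; total = λ s → let c = hasChild tr (proj₁ s) (proj₂ s)
                  in (proj₁ s ∷ʳ proj₁ c , proj₂ c) , proj₁ c , refl
  }

treeLabel : (tr : TreeStructure) → (List ℕ → Bool) → State (treeFrame tr) → Bool
treeLabel tr V s = V (proj₁ s)

nodeAt : (tr : TreeStructure) → Path (treeFrame tr) → ℕ → List ℕ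
nodeAt tr π j = proj₁ (at π j)

-- Regular tree structure: (isomorphic to) the unwinding of a finite Kripke
-- structure, i.e. there is a finite Kripke structure (states Fin m, total
-- relation R') and a map f from nodes to its states sending the root to an
-- initial state, preserving labels, and mapping the children of every node
-- bijectively onto the successors of its image.
record IsRegular (tr : TreeStructure) (V : List ℕ → Bool) : Set₁ where
  field
    m         : ℕ
    Init'     : Fin m → Set
    R'        : Fin m → Fin m → Set
    L'        : Fin m → Bool
    total'    : ∀ s → ∃ λ t → R' s t
    f         : List ℕ → Fin m
    rootInit  : Init' (f [])
    labelOk   : ∀ τ → T tr τ ≡ true → L' (f τ) ≡ V τ
    childOk   : ∀ τ i → T tr (τ ∷ʳ i) ≡ true → R' (f τ) (f (τ ∷ʳ i))
    childOnto : ∀ τ → T tr τ ≡ true → ∀ t → R' (f τ) t →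
                ∃ λ i → T tr (τ ∷ʳ i) ≡ true × f (τ ∷ʳ i) ≡ t
    childInj  : ∀ τ i j → T tr (τ ∷ʳ i) ≡ true → T tr (τ ∷ʳ j) ≡ true →
                f (τ ∷ʳ i) ≡ f (τ ∷ʳ j) → i ≡ j

-- The expected trace  {p} w 0^z {p}^ω  for a word w of length ℓ.
expTrace : {ℓ : ℕ} → ℕ → Vec Bool ℓ → ℕ → Bool
expTrace z w zero = true
expTrace {ℓ} z w (suc i) with i <? ℓ
... | yes i<ℓ = lookup w (fromℕ< i<ℓ)
... | no  _   with i <? ℓ + z
...   | yes _ = false
...   | no  _ = true

-- The K_n conditions.  Successors of the root are indexed by
-- Fin (2n+1): index 0 is η, index k ∈ [1,2n] is ξ_k.  ℓ_n = suc m with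
-- 1 ≤ m (i.e. ℓ_n > 1).
record IsKn (n : ℕ) (tr : TreeStructure) (V : List ℕ → Bool) : Set where
  field
    m        : ℕ
    1≤m      : 1 ≤ m
    rootLab  : V [] ≡ true
    succ     : Fin (suc (2 * n)) → ℕ
    succNode : ∀ k → T tr (succ k ∷ []) ≡ true
    succInj  : ∀ k k′ → succ k ≡ succ k′ → k ≡ k′
    succAll  : ∀ i → T tr (i ∷ []) ≡ true → ∃ λ k → succ k ≡ i
    path     : Fin (suc (2 * n)) → InitPath (treeFrame tr)
    pathThru : ∀ k → nodeAt tr (proj₁ (path k)) 1 ≡ succ k ∷ []
    pathUniq : ∀ k (π : InitPath (treeFrame tr)) →
               nodeAt tr (proj₁ π) 1 ≡ succ k ∷ [] →
               ∀ j → nodeAt tr (proj₁ π) j ≡ nodeAt tr (proj₁ (path k)) j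
    w        : Fin (suc (2 * n)) → Vec Bool (suc m)
    wInj     : ∀ k k′ → w k ≡ w k′ → k ≡ k′
    w0       : ∀ k → toℕ k ≡ 0 → w k ≡ replicate (suc m) true
    wn       : ∀ k → toℕ k ≡ n → last (w k) ≡ false
    wn-1     : ∀ k → toℕ k ≡ n ∸ 1 → last (w k) ≡ true
    traceη   : ∀ k → toℕ k ≡ 0 → ∀ j →
               V (nodeAt tr (proj₁ (path k)) j) ≡ expTrace n (w k) j
    traceξ   : ∀ k → 1 ≤ toℕ k → ∀ j →
               V (nodeAt tr (proj₁ (path k)) j) ≡ expTrace (2 * n ∸ toℕ k) (w k) j

-- n < 2n+1, to name the index of ξ_n
n<1+2n : ∀ n → n < suc (2 * n)
n<1+2n n = s≤s (Data.Nat.Properties.m≤m+n n (n + 0))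
  where import Data.Nat.Properties

-- M_n: the label of the node π(ξ_n)(ℓ_n + 1 + n) is replaced by ∅
MLabel : {n : ℕ} {tr : TreeStructure} {V : List ℕ → Bool} →
         IsKn n tr V → List ℕ → Bool
MLabel {n} {tr} {V} K τ =
  if ⌊ LP.≡-dec _≟_ τ (nodeAt tr (proj₁ (IsKn.path K (fromℕ< (n<1+2n n))))
                              (suc (IsKn.m K) + 1 + n)) ⌋
  then false else V τ

module Submission where

-- Every initial path of the tree follows one root branch a ∈ {η, ξ_1, …, ξ_2n},
-- and in M_n the trace of branch a has the shape {p} w_a ∅^(g a) {p}^ω, where the
-- "gap" g a is n for η, n+1 for ξ_n (one ∅ was added) and 2n−k for ξ_k otherwise.
-- A model of φ_p yields branches a, b and a position j with p on the trace of a
-- at all positions ≤ j, ¬p on the trace of b at j, and equal traces after j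
-- (a "split").  No split exists:
--   * if j > ℓ_n, then w_a = {p}^ℓ_n, so a = η, but η has ∅ at position ℓ_n + 1;
--   * if j ≤ ℓ_n, the traces agree after the words, so g a = g b; as a ≠ b this
--     forces {a, b} = {ξ_(n−1), ξ_n}; then j = ℓ_n would again force a = η, and
--     j < ℓ_n contradicts last(w_(n−1)) = {p} ≠ ∅ = last(w_n) at position ℓ_n.

open import Defs
open import Data.Nat using (ℕ; zero; suc; _+_; _*_; _∸_; _≤_; _<_; s≤s; z≤n; _≟_; _<?_; s≤s⁻¹)
open import Data.Nat.Properties
open import Data.Fin using (Fin; toℕ; fromℕ<; fromℕ) renaming (zero to fzero)
import Data.Fin as Fin
open import Data.Fin.Properties using (toℕ-injective; toℕ<n; toℕ-fromℕ<; fromℕ<-toℕ; toℕ-fromℕ)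
open import Data.Bool using (Bool; true; false)
open import Data.Bool.Properties using (¬-not)
open import Data.List using (List; []; _∷_; _∷ʳ_; length)
import Data.List.Properties as LP
open import Data.Vec using (Vec; lookup; last; replicate; tabulate) renaming (_∷_ to _∷v_; [] to []v)
open import Data.Vec.Properties using (lookup-replicate; tabulate-cong; tabulate∘lookup)
open import Data.Product using (∃; ∃₂; _×_; _,_; proj₁; proj₂)
open import Data.Sum using (_⊎_; inj₁; inj₂)
open import Data.Empty using (⊥; ⊥-elim)
open import Data.Unit using (tt)
open import Function using (_∘_)
open import Relation.Nullary using (¬_; yes; no; contradiction)
open import Relation.Binary.PropositionalEquality
open import Relation.Binary.Definitions using (tri<; tri≈; tri>)
open ≡-Reasoning

lookup-extensional : ∀ {A : Set} {k} (xs ys : Vec A k) →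
                     (∀ i → lookup xs i ≡ lookup ys i) → xs ≡ ys
lookup-extensional xs ys same = begin
  xs                   ≡⟨ sym (tabulate∘lookup xs) ⟩
  tabulate (lookup xs) ≡⟨ tabulate-cong same ⟩
  tabulate (lookup ys) ≡⟨ tabulate∘lookup ys ⟩
  ys                   ∎

last≡lookup-fromℕ : ∀ {A : Set} k (xs : Vec A (suc k)) → last xs ≡ lookup xs (fromℕ k)
last≡lookup-fromℕ zero    (x ∷v []v) = refl
last≡lookup-fromℕ (suc k) (x ∷v xs)  = last≡lookup-fromℕ k xs

expTrace-word : ∀ {ℓ} z (w : Vec Bool ℓ) (f : Fin ℓ) → expTrace z w (suc (toℕ f)) ≡ lookup w f
expTrace-word {ℓ} z w f with toℕ f <? ℓ
... | yes f<ℓ = cong (lookup w) (fromℕ<-toℕ f f<ℓ)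
... | no  f≮ℓ = ⊥-elim (f≮ℓ (toℕ<n f))

expTrace-last : ∀ {m} z (w : Vec Bool (suc m)) → expTrace z w (suc m) ≡ last w
expTrace-last {m} z w = begin
  expTrace z w (suc m)                  ≡⟨ cong (expTrace z w ∘ suc) (sym (toℕ-fromℕ m)) ⟩
  expTrace z w (suc (toℕ (fromℕ m)))    ≡⟨ expTrace-word z w (fromℕ m) ⟩
  lookup w (fromℕ m)                    ≡⟨ sym (last≡lookup-fromℕ m w) ⟩
  last w                                ∎

expTrace-gap : ∀ {ℓ} z (w : Vec Bool ℓ) i → ℓ ≤ i → i < ℓ + z → expTrace z w (suc i) ≡ false
expTrace-gap {ℓ} z w i ℓ≤i i<ℓ+z with i <? ℓ
... | yes i<ℓ = ⊥-elim (<⇒≱ i<ℓ ℓ≤i)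
... | no  _ with i <? ℓ + z
...   | yes _  = refl
...   | no  i≮ = ⊥-elim (i≮ i<ℓ+z)

expTrace-tail : ∀ {ℓ} z (w : Vec Bool ℓ) i → ℓ + z ≤ i → expTrace z w (suc i) ≡ true
expTrace-tail {ℓ} z w i ℓ+z≤i with i <? ℓ
... | yes i<ℓ = ⊥-elim (<⇒≱ i<ℓ (≤-trans (m≤m+n ℓ z) ℓ+z≤i))
... | no  _ with i <? ℓ + z
...   | yes i<ℓ+z = ⊥-elim (<⇒≱ i<ℓ+z ℓ+z≤i)
...   | no  _     = refl

expTrace-stretch : ∀ {ℓ} z (w : Vec Bool ℓ) i → i ≢ ℓ + z →
                   expTrace z w (suc i) ≡ expTrace (suc z) w (suc i)
expTrace-stretch {ℓ} z w i i≢ with i <? ℓ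
... | yes _ = refl
... | no  _ with i <? ℓ + z | i <? ℓ + suc z
...   | yes _   | yes _   = refl
...   | no  _   | no  _   = refl
...   | yes lt  | no  lt′ = ⊥-elim (lt′ (≤-trans lt (+-monoʳ-≤ ℓ (n≤1+n z))))
...   | no  ge  | yes lt  = ⊥-elim (i≢ (≤-antisym (s≤s⁻¹ (subst (i <_) (+-suc ℓ z) lt)) (≮⇒≥ ge)))

expTrace-allTrue : ∀ {ℓ} z (w : Vec Bool ℓ) →
                   (∀ k → k ≤ ℓ → expTrace z w k ≡ true) → w ≡ replicate ℓ true
expTrace-allTrue z w allTrue = lookup-extensional _ _ λ f → begin
  lookup w f                     ≡⟨ sym (expTrace-word z w f) ⟩
  expTrace z w (suc (toℕ f))     ≡⟨ allTrue _ (toℕ<n f) ⟩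
  true                           ≡⟨ sym (lookup-replicate f true) ⟩
  lookup (replicate _ true) f    ∎

SameTail : ∀ {ℓ} → ℕ → Vec Bool ℓ → ℕ → Vec Bool ℓ → Set
SameTail {ℓ} z w z′ w′ = ∀ i → ℓ ≤ i → expTrace z w (suc i) ≡ expTrace z′ w′ (suc i)

-- At position ℓ + z a gap of length z has ended while a longer gap has not.
shorterGap-differs : ∀ {ℓ} z (w : Vec Bool ℓ) z′ (w′ : Vec Bool ℓ) → z < z′ → ¬ SameTail z w z′ w′
shorterGap-differs {ℓ} z w z′ w′ z<z′ same with () ← begin
  true                           ≡⟨ sym (expTrace-tail z w (ℓ + z) ≤-refl) ⟩
  expTrace z w (suc (ℓ + z))     ≡⟨ same (ℓ + z) (m≤m+n ℓ z) ⟩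
  expTrace z′ w′ (suc (ℓ + z))   ≡⟨ expTrace-gap z′ w′ (ℓ + z) (m≤m+n ℓ z) (+-monoʳ-< ℓ z<z′) ⟩
  false                          ∎

SameTail⇒sameGap : ∀ {ℓ} z (w : Vec Bool ℓ) z′ (w′ : Vec Bool ℓ) → SameTail z w z′ w′ → z ≡ z′
SameTail⇒sameGap z w z′ w′ same with <-cmp z z′
... | tri≈ _ z≡z′ _ = z≡z′
... | tri< z<z′ _ _ = ⊥-elim (shorterGap-differs z w z′ w′ z<z′ same)
... | tri> _ _ z′<z = ⊥-elim (shorterGap-differs z′ w′ z w z′<z (λ i ℓ≤i → sym (same i ℓ≤i)))

-- The trace content of φ_p: the x-trace s has p up to and including position j,
-- the y-trace t lacks p at j, and the two traces coincide after j.
record Split (s t : ℕ → Bool) (j : ℕ) : Set where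
  field
    prefix : ∀ k → k ≤ j → s k ≡ true
    differ : t j ≡ false
    agree  : ∀ k → j < k → s k ≡ t k

Split-cong : ∀ {s s′ t t′ j} → (∀ k → s k ≡ s′ k) → (∀ k → t k ≡ t′ k) →
             Split s t j → Split s′ t′ j
Split-cong s≗s′ t≗t′ split = record
  { prefix = λ k k≤j → trans (sym (s≗s′ k)) (prefix k k≤j)
  ; differ = trans (sym (t≗t′ _)) differ
  ; agree  = λ k j<k → trans (sym (s≗s′ k)) (trans (agree k j<k) (t≗t′ k))
  }
  where open Split split

-- The semantics of p[x] ↔ p[y] (through its ¬/∧ encoding, under G's double negation).
⇔-semantics : (a b : Bool) →
              ¬ ¬ ((¬ (a ≡ true × ¬ b ≡ true)) × (¬ (b ≡ true × ¬ a ≡ true))) → a ≡ b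
⇔-semantics true  true  _   = refl
⇔-semantics false false _   = refl
⇔-semantics true  false ¬¬⇔ = ⊥-elim (¬¬⇔ λ (a⇒b , _) → a⇒b (refl , λ ()))
⇔-semantics false true  ¬¬⇔ = ⊥-elim (¬¬⇔ λ (_ , b⇒a) → b⇒a (refl , λ ()))

φp⇒Split : (F : Frame) (V : State F → Bool) → F , V ⊨ φp →
           ∃₂ λ (π₁ π₂ : InitPath F) → ∃ λ j →
             Split (V ∘ at (proj₁ π₁)) (V ∘ at (proj₁ π₂)) j
φp⇒Split F V (_ , _ , π₁ , _ , π₂ , _ , j , _ , ((px , ¬py) , always⇔) , untilPx) =
  π₁ , π₂ , j , record
    { prefix = pThroughJ
    ; differ = ¬-not ¬py
    ; agree  = λ k j<k → ⇔-semantics _ _ (λ ¬⇔ → always⇔ (k , j<k , ¬⇔ , λ _ _ _ → tt))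
    }
  where
  pThroughJ : ∀ k → k ≤ j → V (at (proj₁ π₁) k) ≡ true
  pThroughJ k k≤j with m≤n⇒m<n∨m≡n k≤j
  ... | inj₁ k<j  = untilPx k z≤n k<j
  ... | inj₂ refl = px

module TreePaths (tr : TreeStructure) where

  depth-nodeAt : (π : InitPath (treeFrame tr)) → ∀ k → length (nodeAt tr (proj₁ π) k) ≡ k
  depth-nodeAt π zero = cong length (proj₂ π)
  depth-nodeAt π (suc k) with step (proj₁ π) k
  ... | c , child = begin
    length (nodeAt tr (proj₁ π) (suc k))    ≡⟨ cong length child ⟩
    length (nodeAt tr (proj₁ π) k ∷ʳ c)     ≡⟨ LP.length-++ (nodeAt tr (proj₁ π) k) ⟩
    length (nodeAt tr (proj₁ π) k) + 1      ≡⟨ +-comm _ 1 ⟩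
    suc (length (nodeAt tr (proj₁ π) k))    ≡⟨ cong suc (depth-nodeAt π k) ⟩
    suc k                                   ∎

  firstStep : (π : InitPath (treeFrame tr)) →
              ∃ λ c → nodeAt tr (proj₁ π) 1 ≡ c ∷ [] × T tr (c ∷ []) ≡ true
  firstStep π with step (proj₁ π) 0
  ... | c , child = c , atOne , subst (λ τ → T tr τ ≡ true) atOne (proj₂ (at (proj₁ π) 1))
    where atOne = trans child (cong (_∷ʳ c) (proj₂ π))

  belowFirst : (π : InitPath (treeFrame tr)) → ∀ c → nodeAt tr (proj₁ π) 1 ≡ c ∷ [] →
               ∀ k → ∃ λ rest → nodeAt tr (proj₁ π) (suc k) ≡ c ∷ rest
  belowFirst π c atOne zero = [] , atOne
  belowFirst π c atOne (suc k) with belowFirst π c atOne k | step (proj₁ π) (suc k)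
  ... | rest , below | d , child = rest ∷ʳ d , trans child (cong (_∷ʳ d) below)

module KnMn (n : ℕ) (1<n : 1 < n) (tr : TreeStructure) (V : List ℕ → Bool) (K : IsKn n tr V) where
  open IsKn K
  open TreePaths tr

  Branch : Set
  Branch = Fin (suc (2 * n))

  ℓ : ℕ
  ℓ = suc m

  node : Branch → ℕ → List ℕ
  node a = nodeAt tr (proj₁ (path a))

  ξn : Branch
  ξn = fromℕ< (n<1+2n n)

  toℕ-ξn : toℕ ξn ≡ n
  toℕ-ξn = toℕ-fromℕ< (n<1+2n n)

  η≢ξn : ∀ {a} → toℕ a ≡ 0 → a ≢ ξn
  η≢ξn a≡0 a≡ξn = <⇒≢ (<⇒≤ 1<n) (sym (trans (sym toℕ-ξn) (trans (cong toℕ (sym a≡ξn)) a≡0)))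

  index≤2n : ∀ a → toℕ a ≤ 2 * n
  index≤2n a = s≤s⁻¹ (toℕ<n a)

  followsBranch : (π : InitPath (treeFrame tr)) →
                  ∃ λ a → ∀ k → nodeAt tr (proj₁ π) k ≡ node a k
  followsBranch π with firstStep π
  ... | c , atOne , isNode with succAll c isNode
  ...   | a , succ≡c = a , pathUniq a π (trans atOne (cong (_∷ []) (sym succ≡c)))

  pos* : ℕ
  pos* = suc m + 1 + n

  pos*≡ : pos* ≡ suc (ℓ + n)
  pos*≡ = cong (λ q → suc (q + n)) (+-comm m 1)

  node* : List ℕ
  node* = node ξn pos*

  MLabel-node* : MLabel K node* ≡ false
  MLabel-node* with LP.≡-dec _≟_ node* node*
  ... | yes _   = refl
  ... | no  ≢refl = ⊥-elim (≢refl refl)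

  MLabel-other : ∀ τ → τ ≢ node* → MLabel K τ ≡ V τ
  MLabel-other τ τ≢ with LP.≡-dec _≟_ τ node*
  ... | yes τ≡ = ⊥-elim (τ≢ τ≡)
  ... | no  _  = refl

  -- Only ξ_n visits node*, and only at position pos* (nodes record their depth
  -- and their root branch).
  visits-node* : ∀ a k → node a k ≡ node* → a ≡ ξn × k ≡ pos*
  visits-node* a k at* = sameBranch , k≡pos*
    where
    k≡pos* : k ≡ pos*
    k≡pos* = begin
      k                    ≡⟨ sym (depth-nodeAt (path a) k) ⟩
      length (node a k)    ≡⟨ cong length at* ⟩
      length node*         ≡⟨ depth-nodeAt (path ξn) pos* ⟩
      pos*                 ∎
    sameBranch : a ≡ ξn
    sameBranch with belowFirst (path a) _ (pathThru a) (m + 1 + n)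
                  | belowFirst (path ξn) _ (pathThru ξn) (m + 1 + n)
    ... | restA , belowA | restξ , belowξ = succInj a ξn (LP.∷-injectiveˡ (begin
      succ a ∷ restA       ≡⟨ sym belowA ⟩
      node a pos*          ≡⟨ subst (λ q → node a q ≡ node*) k≡pos* at* ⟩
      node*                ≡⟨ belowξ ⟩
      succ ξn ∷ restξ      ∎))

  gapK : Branch → ℕ
  gapK a with toℕ a ≟ 0
  ... | yes _ = n
  ... | no  _ = 2 * n ∸ toℕ a

  traceK : ∀ a k → V (node a k) ≡ expTrace (gapK a) (w a) k
  traceK a k with toℕ a ≟ 0
  ... | yes a≡0 = traceη a a≡0 k
  ... | no  a≢0 = traceξ a (n≢0⇒n>0 a≢0) k

  gapK-η : ∀ {a} → toℕ a ≡ 0 → gapK a ≡ n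
  gapK-η {a} a≡0 with toℕ a ≟ 0
  ... | yes _   = refl
  ... | no  a≢0 = ⊥-elim (a≢0 a≡0)

  gapK-ξ : ∀ {a} → toℕ a ≢ 0 → gapK a ≡ 2 * n ∸ toℕ a
  gapK-ξ {a} a≢0 with toℕ a ≟ 0
  ... | yes a≡0 = ⊥-elim (a≢0 a≡0)
  ... | no  _   = refl

  gapK-ξn : gapK ξn ≡ n
  gapK-ξn = begin
    gapK ξn              ≡⟨ gapK-ξ (λ ξn≡0 → η≢ξn ξn≡0 refl) ⟩
    2 * n ∸ toℕ ξn       ≡⟨ cong (2 * n ∸_) toℕ-ξn ⟩
    n + (n + 0) ∸ n      ≡⟨ m+n∸m≡n n (n + 0) ⟩
    n + 0                ≡⟨ +-identityʳ n ⟩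
    n                    ∎

  gapM : Branch → ℕ
  gapM a with a Fin.≟ ξn
  ... | yes _ = suc n
  ... | no  _ = gapK a

  gapM-ξn : gapM ξn ≡ suc n
  gapM-ξn with ξn Fin.≟ ξn
  ... | yes _   = refl
  ... | no  ≢ξn = ⊥-elim (≢ξn refl)

  gapM-other : ∀ {a} → a ≢ ξn → gapM a ≡ gapK a
  gapM-other {a} a≢ξn with a Fin.≟ ξn
  ... | yes a≡ξn = ⊥-elim (a≢ξn a≡ξn)
  ... | no  _    = refl

  gapM-η : ∀ {a} → toℕ a ≡ 0 → gapM a ≡ n
  gapM-η a≡0 = trans (gapM-other (η≢ξn a≡0)) (gapK-η a≡0)

  traceOf : Branch → ℕ → Bool
  traceOf a = expTrace (gapM a) (w a)

  traceM-ξn : ∀ k → MLabel K (node ξn k) ≡ expTrace (suc n) (w ξn) k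
  traceM-ξn k with k ≟ pos*
  ... | yes refl = begin
    MLabel K node*                        ≡⟨ MLabel-node* ⟩
    false                                 ≡⟨ sym (expTrace-gap (suc n) (w ξn) (ℓ + n)
                                                   (m≤m+n ℓ n) (+-monoʳ-< ℓ (n<1+n n))) ⟩
    expTrace (suc n) (w ξn) (suc (ℓ + n)) ≡⟨ cong (expTrace (suc n) (w ξn)) (sym pos*≡) ⟩
    expTrace (suc n) (w ξn) pos*          ∎
  ... | no k≢pos* = begin
    MLabel K (node ξn k)                  ≡⟨ MLabel-other _ (k≢pos* ∘ proj₂ ∘ visits-node* ξn k) ⟩
    V (node ξn k)                         ≡⟨ traceK ξn k ⟩
    expTrace (gapK ξn) (w ξn) k           ≡⟨ cong (λ z → expTrace z (w ξn) k) gapK-ξn ⟩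
    expTrace n (w ξn) k                   ≡⟨ stretchedAway k k≢pos* ⟩
    expTrace (suc n) (w ξn) k             ∎
    where
    stretchedAway : ∀ k → k ≢ pos* → expTrace n (w ξn) k ≡ expTrace (suc n) (w ξn) k
    stretchedAway zero    _  = refl
    stretchedAway (suc i) i≢ = expTrace-stretch n (w ξn) i (λ i≡ → i≢ (trans (cong suc i≡) (sym pos*≡)))

  traceM : ∀ a k → MLabel K (node a k) ≡ traceOf a k
  traceM a k with a Fin.≟ ξn
  ... | yes refl = traceM-ξn k
  ... | no a≢ξn = trans (MLabel-other _ (a≢ξn ∘ proj₁ ∘ visits-node* a k)) (traceK a k)

  branchTrace : (π : InitPath (treeFrame tr)) →
                ∃ λ a → ∀ k → MLabel K (nodeAt tr (proj₁ π) k) ≡ traceOf a k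
  branchTrace π with followsBranch π
  ... | a , follows = a , λ k → trans (cong (MLabel K) (follows k)) (traceM a k)

  data GapView (a : Branch) : Set where
    η-gap  : toℕ a ≡ 0 → gapM a ≡ n → GapView a
    ξn-gap : a ≡ ξn → gapM a ≡ suc n → GapView a
    ξk-gap : toℕ a ≢ 0 → a ≢ ξn → gapM a ≡ 2 * n ∸ toℕ a → GapView a

  gapView : ∀ a → GapView a
  gapView a with a Fin.≟ ξn | toℕ a ≟ 0
  ... | yes a≡ξn | _       = ξn-gap a≡ξn (trans (cong gapM a≡ξn) gapM-ξn)
  ... | no  _    | yes a≡0 = η-gap a≡0 (gapM-η a≡0)
  ... | no  a≢ξn | no  a≢0 = ξk-gap a≢0 a≢ξn (trans (gapM-other a≢ξn) (gapK-ξ a≢0))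

  gap+index : ∀ a c → 2 * n ∸ toℕ a ≡ c → c + toℕ a ≡ n + n
  gap+index a c gap≡c = begin
    c + toℕ a                  ≡⟨ cong (_+ toℕ a) (sym gap≡c) ⟩
    2 * n ∸ toℕ a + toℕ a      ≡⟨ m∸n+n≡m (index≤2n a) ⟩
    n + (n + 0)                ≡⟨ cong (n +_) (+-identityʳ n) ⟩
    n + n                      ∎

  gap≡n⇒η : ∀ a → gapM a ≡ n → toℕ a ≡ 0
  gap≡n⇒η a gap≡n with gapView a
  ... | η-gap a≡0 _ = a≡0
  ... | ξn-gap _ gapA = ⊥-elim (<⇒≢ (n<1+n n) (sym (trans (sym gapA) gap≡n)))
  ... | ξk-gap _ a≢ξn gapA = ⊥-elim (a≢ξn (toℕ-injective (trans a≡n (sym toℕ-ξn))))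
    where
    a≡n : toℕ a ≡ n
    a≡n = +-cancelˡ-≡ n (toℕ a) n (gap+index a n (trans (sym gapA) gap≡n))

  gap≡1+n⇒ξn-1 : ∀ a → a ≢ ξn → gapM a ≡ suc n → toℕ a ≡ n ∸ 1
  gap≡1+n⇒ξn-1 a a≢ξn gap≡1+n with gapView a
  ... | η-gap _ gapA = ⊥-elim (<⇒≢ (n<1+n n) (trans (sym gapA) gap≡1+n))
  ... | ξn-gap a≡ξn _ = ⊥-elim (a≢ξn a≡ξn)
  ... | ξk-gap _ _ gapA = cong (_∸ 1) (+-cancelˡ-≡ n (suc (toℕ a)) n
          (trans (+-suc n (toℕ a)) (gap+index a (suc n) (trans (sym gapA) gap≡1+n))))

  Partners : Branch → Branch → Set
  Partners a b = (toℕ a ≡ n ∸ 1 × b ≡ ξn) ⊎ (a ≡ ξn × toℕ b ≡ n ∸ 1)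

  sameGap⇒partners : ∀ a b → gapM a ≡ gapM b → a ≢ b → Partners a b
  sameGap⇒partners a b same a≢b with gapView a | gapView b
  ... | η-gap a≡0 gapA | _ =
    ⊥-elim (a≢b (toℕ-injective (trans a≡0 (sym (gap≡n⇒η b (trans (sym same) gapA))))))
  ... | _ | η-gap b≡0 gapB =
    ⊥-elim (a≢b (toℕ-injective (trans (gap≡n⇒η a (trans same gapB)) (sym b≡0))))
  ... | ξn-gap a≡ξn _ | ξn-gap b≡ξn _ = ⊥-elim (a≢b (trans a≡ξn (sym b≡ξn)))
  ... | ξn-gap a≡ξn gapA | ξk-gap _ b≢ξn _ =
    inj₂ (a≡ξn , gap≡1+n⇒ξn-1 b b≢ξn (trans (sym same) gapA))
  ... | ξk-gap _ a≢ξn _ | ξn-gap b≡ξn gapB =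
    inj₁ (gap≡1+n⇒ξn-1 a a≢ξn (trans same gapB) , b≡ξn)
  ... | ξk-gap _ _ gapA | ξk-gap _ _ gapB = ⊥-elim (a≢b (toℕ-injective
          (∸-cancelˡ-≡ (index≤2n a) (index≤2n b) (trans (sym gapA) (trans same gapB)))))

  partner-notη : ∀ a b → Partners a b → toℕ a ≢ 0
  partner-notη a b (inj₁ (a≡n-1 , _)) a≡0 = <⇒≢ (∸-monoˡ-≤ 1 1<n) (sym (trans (sym a≡n-1) a≡0))
  partner-notη a b (inj₂ (a≡ξn , _))  a≡0 = η≢ξn a≡0 a≡ξn

  partner-lastDiffer : ∀ a b → Partners a b → last (w a) ≢ last (w b)
  partner-lastDiffer a b (inj₁ (a≡n-1 , refl)) same with () ← begin
    true          ≡⟨ sym (wn-1 a a≡n-1) ⟩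
    last (w a)    ≡⟨ same ⟩
    last (w ξn)   ≡⟨ wn ξn toℕ-ξn ⟩
    false         ∎
  partner-lastDiffer a b (inj₂ (refl , b≡n-1)) same with () ← begin
    true          ≡⟨ sym (wn-1 b b≡n-1) ⟩
    last (w b)    ≡⟨ sym same ⟩
    last (w ξn)   ≡⟨ wn ξn toℕ-ξn ⟩
    false         ∎

  prefix⇒η : ∀ a → (∀ k → k ≤ ℓ → traceOf a k ≡ true) → toℕ a ≡ 0
  prefix⇒η a allTrue =
    cong toℕ (wInj a fzero (trans (expTrace-allTrue (gapM a) (w a) allTrue) (sym (w0 fzero refl))))

  η-gapStart : ∀ a → toℕ a ≡ 0 → traceOf a (suc ℓ) ≡ false
  η-gapStart a a≡0 = expTrace-gap (gapM a) (w a) ℓ ≤-refl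
                       (subst (λ z → ℓ < ℓ + z) (sym (gapM-η a≡0)) (m<m+n ℓ (<⇒≤ 1<n)))

  module NoSplit (a b : Branch) (j : ℕ) (split : Split (traceOf a) (traceOf b) j) where
    open Split split

    -- a split position carries p on a but not on b, so the branches differ
    a≢b : a ≢ b
    a≢b refl = contradiction (trans (sym (prefix j ≤-refl)) differ) λ ()

    -- if the split is within the words, the traces agree after them:
    -- the branches are partners
    partners : j ≤ ℓ → Partners a b
    partners j≤ℓ = sameGap⇒partners a b
      (SameTail⇒sameGap (gapM a) (w a) (gapM b) (w b)
        λ i ℓ≤i → agree (suc i) (s≤s (≤-trans j≤ℓ ℓ≤i))) a≢b

    -- p on a up to ℓ forces a = η, whose ∅-block starts at ℓ + 1 ≤ j
    pastWord : ℓ < j → ⊥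
    pastWord ℓ<j with () ← begin
      true                 ≡⟨ sym (prefix (suc ℓ) ℓ<j) ⟩
      traceOf a (suc ℓ)    ≡⟨ η-gapStart a (prefix⇒η a λ k k≤ℓ → prefix k (≤-trans k≤ℓ (<⇒≤ ℓ<j))) ⟩
      false                ∎

    -- p on a up to ℓ again forces a = η, which is no partner
    atWordEnd : j ≡ ℓ → ⊥
    atWordEnd refl = partner-notη a b (partners ≤-refl) (prefix⇒η a prefix)

    -- position ℓ lies after j, but the partners' words end differently
    insideWord : j < ℓ → ⊥
    insideWord j<ℓ = partner-lastDiffer a b (partners (<⇒≤ j<ℓ)) (begin
      last (w a)      ≡⟨ sym (expTrace-last (gapM a) (w a)) ⟩
      traceOf a ℓ     ≡⟨ agree ℓ j<ℓ ⟩
      traceOf b ℓ     ≡⟨ expTrace-last (gapM b) (w b) ⟩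
      last (w b)      ∎)

    impossible : ⊥
    impossible with <-cmp j ℓ
    ... | tri< j<ℓ _ _ = insideWord j<ℓ
    ... | tri≈ _ j≡ℓ _ = atWordEnd j≡ℓ
    ... | tri> _ _ ℓ<j = pastWord ℓ<j

  noSplit : ∀ a b j → ¬ Split (traceOf a) (traceOf b) j
  noSplit a b j split = NoSplit.impossible a b j split

-- A model of φ_p in M_n would give a split of two branch traces.
proposition2 : (n : ℕ) → 1 < n →
    (tr : TreeStructure) (V : List ℕ → Bool) → IsRegular tr V →
    (K : IsKn n tr V) →
    ¬ (treeFrame tr , treeLabel tr (MLabel K) ⊨ φp)
proposition2 n 1<n tr V _ K Mn⊨φp =
  let (π₁ , π₂ , j , split) = φp⇒Split (treeFrame tr) (treeLabel tr (MLabel K)) Mn⊨φp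
      (a , π₁-trace) = branchTrace π₁
      (b , π₂-trace) = branchTrace π₂
  in  noSplit a b j (Split-cong π₁-trace π₂-trace split)
  where open KnMn n 1<n tr V K
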